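{- For a series-parallel digraph $D$, the parameter $\phi(D)$ is well-defined, i.e., it does not depend on the choice of the binary decomposition tree of $D$.
   Context: A series-parallel digraph with source $s$ and sink $t$ is either a single arc or the series composition (sink of the first identified with source of the second) or parallel composition (sources identified, sinks identified; parallel arcs allowed) of two series-parallel digraphs. A binary decomposition tree of $D$ has the arcs of $D$ as leaves and internal vertices labeled $S$ or $P$, each representing the series or parallel composition of the graphs of its two children, the root representing $D$. An $S$-component is a maximal connected set of $S$-labeled tree vertices. $\phi(D)$ is defined, for a given binary decomposition tree, as the maximum over root-to-leaf paths of the number of $S$-components traversed. -}

module Defs where

open import Data.Nat using (ℕ; zero; suc; _+_; _⊔_)
open import Data.Fin using (Fin)
open import Data.Bool using (Bool; true; false; if_then_else_)
open import Data.List using (List; []; _∷_; _++_)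
open import Data.List.Membership.Propositional using (_∈_)
open import Data.List.Relation.Binary.Permutation.Propositional using (_↭_)
open import Data.Fin using (Fin)
open import Data.Product using (Σ; ∃; _×_)
open import Data.Sum using (_⊎_)
open import Relation.Binary.PropositionalEquality using (_≡_)
open import Relation.Nullary using (¬_)
import Data.List as List

record Digraph : Set where
  field
    nV   : ℕ
    nA   : ℕ
    tail : Fin nA → Fin nV
    head : Fin nA → Fin nV
open Digraph public

data Label : Set where
  S P : Label

data Tree (m : ℕ) : Set where
  leaf : Fin m → Tree m
  node : Label → Tree m → Tree m → Tree m

leaves : ∀ {m} → Tree m → List (Fin m)
leaves (leaf a) = a ∷ []
leaves (node _ l r) = leaves l ++ leaves r

VertexOf : (D : Digraph) → Tree (nA D) → Fin (nV D) → Set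
VertexOf D T x = ∃ λ a → a ∈ leaves T × (tail D a ≡ x ⊎ head D a ≡ x)

-- Realizes D T u v : the subgraph of D consisting of the leaf arcs of T is exactly the
-- series-parallel digraph with source u and sink v built by the composition tree T
-- (series: the two parts share only the middle vertex; parallel: only the terminals).
Realizes : (D : Digraph) → Tree (nA D) → Fin (nV D) → Fin (nV D) → Set
Realizes D (leaf a) u v = tail D a ≡ u × head D a ≡ v × ¬ (u ≡ v)
Realizes D (node S l r) u v =
  ∃ λ w → Realizes D l u w × Realizes D r w v
        × (∀ x → VertexOf D l x → VertexOf D r x → x ≡ w)
Realizes D (node P l r) u v =
  Realizes D l u v × Realizes D r u v
  × (∀ x → VertexOf D l x → VertexOf D r x → x ≡ u ⊎ x ≡ v)

IsDecompTree : (D : Digraph) → Fin (nV D) → Fin (nV D) → Tree (nA D) → Set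
IsDecompTree D s t T =
  (leaves T ↭ List.allFin (nA D))
  × (∀ x → VertexOf D T x)
  × Realizes D T s t

-- φ-aux b T : maximum over root-to-leaf paths of T of the number of S-components met,
-- where b records whether the parent of the current vertex is S-labelled (so that an
-- S-vertex below an S-vertex lies in the same S-component and is not counted again).
φ-aux : ∀ {m} → Bool → Tree m → ℕ
φ-aux b (leaf _) = 0
φ-aux b (node S l r) = (if b then 0 else 1) + (φ-aux true l ⊔ φ-aux true r)
φ-aux b (node P l r) = φ-aux false l ⊔ φ-aux false r

φ : ∀ {m} → Tree m → ℕ
φ = φ-aux false

{-# OPTIONS --safe #-}

-- φ of a series composition is 1 + the largest φ of its S-factors (the maximal non-series
-- subtrees below its top S-component); φ of any other tree is the largest φ of its P-factors.
-- These factors are determined by the digraph. A non-series piece inside a series composition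
-- cannot straddle the cut vertex, and a non-parallel piece inside a parallel composition cannot
-- be split between branches that meet only at the terminals; so every factor of one tree lies
-- inside a factor of the other. Two factors of one tree sharing an arc have the same arcs, hence
-- the factors of the two trees match up with equal arc sets and equal terminals, and the two
-- roots have the same type.

module Submission where

open import Defs
open import Data.Bool using (Bool; true; false)
open import Data.Empty using (⊥; ⊥-elim)
open import Data.Fin using (Fin; _≟_)
open import Data.List using (List; _++_)
open import Data.List.Membership.Propositional using (_∈_)
open import Data.List.Membership.Propositional.Properties using (∈-++⁺ˡ; ∈-++⁺ʳ; ∈-++⁻)
open import Data.List.Relation.Binary.Permutation.Propositional using (_↭_; ↭-sym)
open import Data.List.Relation.Binary.Permutation.Propositional.Properties using (∈-resp-↭)
open import Data.List.Relation.Unary.Any using (here; there)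
open import Data.Nat using (ℕ; suc; _+_; _⊔_; _≤_; _<_; z≤n; s≤s)
open import Data.Nat.Induction using (<-wellFounded)
open import Data.Nat.Properties
  using (≤-refl; ≤-trans; ≤-reflexive; <⇒≤; ≤-antisym; m≤m+n; m≤n+m; m≤m⊔n; m≤n⊔m; ⊔-sel)
open import Data.Product using (∃; ∃₂; _×_; _,_; proj₁; proj₂)
open import Data.Sum using (_⊎_; inj₁; inj₂; [_,_])
import Data.Sum as Sum
open import Function using (id; _∘_)
open import Induction.WellFounded using (Acc; acc; WfRec)
open import Level using (0ℓ)
open import Relation.Binary.PropositionalEquality using (_≡_; _≢_; refl; sym; trans; subst; subst₂)
open import Relation.Nullary using (¬_; Dec; yes; no)
open import Relation.Nullary.Decidable using (decidable-stable)
open import Relation.Unary using (Pred; _⊆_; _∪_; _∩_; _≐_; Satisfiable)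
open import Relation.Unary.Properties using (≐-sym; ≐-trans)

_≟ˡ_ : (ℓ ℓ′ : Label) → Dec (ℓ ≡ ℓ′)
S ≟ˡ S = yes refl
S ≟ˡ P = no λ ()
P ≟ˡ S = no λ ()
P ≟ˡ P = yes refl

isS : Label → Bool
isS S = true
isS P = false

module _ {m : ℕ} where

  arcs : Tree m → Pred (Fin m) 0ℓ
  arcs X a = a ∈ leaves X

  arcs-leaf : ∀ {a} {A : Pred (Fin m) 0ℓ} → A a → arcs (leaf a) ⊆ A
  arcs-leaf Aa (here refl) = Aa
  arcs-leaf Aa (there ())

  -- Node lemmas mention leaves l ++ leaves r rather than arcs (node ℓ l r): leaves forgets ℓ,
  -- which could then not be inferred.
  arcs-++ : ∀ l r {A : Pred (Fin m) 0ℓ} → arcs l ⊆ A → arcs r ⊆ A → (_∈ leaves l ++ leaves r) ⊆ A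
  arcs-++ l r l⊆A r⊆A a∈ = [ l⊆A , r⊆A ] (∈-++⁻ (leaves l) a∈)

  left-⊆ : ∀ l r {A : Pred (Fin m) 0ℓ} → (_∈ leaves l ++ leaves r) ⊆ A → arcs l ⊆ A
  left-⊆ l r lr⊆A a∈ = lr⊆A (∈-++⁺ˡ a∈)

  right-⊆ : ∀ l r {A : Pred (Fin m) 0ℓ} → (_∈ leaves l ++ leaves r) ⊆ A → arcs r ⊆ A
  right-⊆ l r lr⊆A a∈ = lr⊆A (∈-++⁺ʳ (leaves l) a∈)

  data Headed (ℓ : Label) : Tree m → Set where
    headed : ∀ {l r} → Headed ℓ (node ℓ l r)

  unheaded-node : ∀ {ℓ ℓ′ l r} → ℓ′ ≢ ℓ → ¬ Headed ℓ (node ℓ′ l r)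
  unheaded-node ℓ′≢ℓ headed = ℓ′≢ℓ refl

  -- X is the ℓ-composition of its ℓ-factors; for ℓ = S the nodes passed on the way down form
  -- the S-component at the root.
  data Factor (ℓ : Label) : Tree m → Tree m → Set where
    root  : ∀ {X} → ¬ Headed ℓ X → Factor ℓ X X
    left  : ∀ {l r F} → Factor ℓ l F → Factor ℓ (node ℓ l r) F
    right : ∀ {l r F} → Factor ℓ r F → Factor ℓ (node ℓ l r) F

  factor-⊆ : ∀ {ℓ X F} → Factor ℓ X F → arcs F ⊆ arcs X
  factor-⊆ (root _)  = id
  factor-⊆ (left f)  a∈ = ∈-++⁺ˡ (factor-⊆ f a∈)
  factor-⊆ (right {l} f) a∈ = ∈-++⁺ʳ (leaves l) (factor-⊆ f a∈)

  factor-unheaded : ∀ {ℓ X F} → Factor ℓ X F → ¬ Headed ℓ F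
  factor-unheaded (root ¬h) = ¬h
  factor-unheaded (left f)  = factor-unheaded f
  factor-unheaded (right f) = factor-unheaded f

  descend-to-factor : ∀ {ℓ} (Inv : Pred (Tree m) 0ℓ) {F : Tree m}
    → (∀ {l r} → Inv (node ℓ l r) → Inv l × Inv r)
    → (∀ {l r} → Inv (node ℓ l r) → arcs F ⊆ arcs (node ℓ l r) → arcs F ⊆ arcs l ⊎ arcs F ⊆ arcs r)
    → ∀ Y → Inv Y → arcs F ⊆ arcs Y → ∃ λ G → Factor ℓ Y G × arcs F ⊆ arcs G
  descend-to-factor Inv children split (leaf a) _ F⊆Y = leaf a , root (λ ()) , F⊆Y
  descend-to-factor {ℓ} Inv {F} children split (node ℓ′ l r) inv F⊆Y with ℓ′ ≟ˡ ℓ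
  ... | no ℓ′≢ℓ = node ℓ′ l r , root (unheaded-node ℓ′≢ℓ) , F⊆Y
  ... | yes refl with split inv F⊆Y
  ...   | inj₁ F⊆l = let G , g , F⊆G = descend-to-factor Inv {F} children split l (proj₁ (children inv)) F⊆l
                     in G , left g , F⊆G
  ...   | inj₂ F⊆r = let G , g , F⊆G = descend-to-factor Inv {F} children split r (proj₂ (children inv)) F⊆r
                     in G , right g , F⊆G

  φ-within : Label → Tree m → ℕ
  φ-within ℓ = φ-aux (isS ℓ)

  φ-within-node : ∀ ℓ l r → φ-within ℓ (node ℓ l r) ≡ φ-within ℓ l ⊔ φ-within ℓ r
  φ-within-node S l r = refl
  φ-within-node P l r = refl

  φ-within-unheaded : ∀ {ℓ X} → ¬ Headed ℓ X → φ-within ℓ X ≡ φ X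
  φ-within-unheaded {P} _ = refl
  φ-within-unheaded {S} {leaf _} _ = refl
  φ-within-unheaded {S} {node P _ _} _ = refl
  φ-within-unheaded {S} {node S _ _} ¬h = ⊥-elim (¬h headed)

  factor-φ≤φ-within : ∀ {ℓ X F} → Factor ℓ X F → φ F ≤ φ-within ℓ X
  factor-φ≤φ-within (root ¬h) = ≤-reflexive (sym (φ-within-unheaded ¬h))
  factor-φ≤φ-within {ℓ} (left {l} {r} f) =
    ≤-trans (factor-φ≤φ-within f) (≤-trans (m≤m⊔n _ _) (≤-reflexive (sym (φ-within-node ℓ l r))))
  factor-φ≤φ-within {ℓ} (right {l} {r} f) =
    ≤-trans (factor-φ≤φ-within f) (≤-trans (m≤n⊔m _ _) (≤-reflexive (sym (φ-within-node ℓ l r))))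

  φ-within-attained : ∀ ℓ X → ∃ λ F → Factor ℓ X F × φ-within ℓ X ≡ φ F
  φ-within-attained ℓ (leaf a) = leaf a , root (λ ()) , refl
  φ-within-attained ℓ (node ℓ′ l r) with ℓ′ ≟ˡ ℓ
  ... | no ℓ′≢ℓ = node ℓ′ l r , root (unheaded-node ℓ′≢ℓ) , φ-within-unheaded (unheaded-node ℓ′≢ℓ)
  ... | yes refl with ⊔-sel (φ-within ℓ l) (φ-within ℓ r)
  ...   | inj₁ eq = let F , f , e = φ-within-attained ℓ l
                    in F , left f , trans (φ-within-node ℓ l r) (trans eq e)
  ...   | inj₂ eq = let F , f , e = φ-within-attained ℓ r
                    in F , right f , trans (φ-within-node ℓ l r) (trans eq e)

  φ-within-≤ : ∀ ℓ {X Y} → (∀ {F} → Factor ℓ X F → ∃ λ G → Factor ℓ Y G × φ F ≤ φ G)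
             → φ-within ℓ X ≤ φ-within ℓ Y
  φ-within-≤ ℓ {X} dominated with φ-within-attained ℓ X
  ... | F , f , eq with dominated f
  ...   | G , g , F≤G = ≤-trans (≤-reflexive eq) (≤-trans F≤G (factor-φ≤φ-within g))

  size : Tree m → ℕ
  size (leaf _)     = 1
  size (node _ l r) = suc (size l + size r)

  factor-size-≤ : ∀ {ℓ X F} → Factor ℓ X F → size F ≤ size X
  proper-factor-smaller : ∀ {ℓ l r F} → Factor ℓ (node ℓ l r) F → size F < size (node ℓ l r)

  factor-size-≤ (root _)  = ≤-refl
  factor-size-≤ (left f)  = <⇒≤ (proper-factor-smaller (left f))
  factor-size-≤ (right f) = <⇒≤ (proper-factor-smaller (right f))

  proper-factor-smaller (root ¬h) = ⊥-elim (¬h headed)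
  proper-factor-smaller {l = l} {r} (left f)  = s≤s (≤-trans (factor-size-≤ f) (m≤m+n (size l) (size r)))
  proper-factor-smaller {l = l} {r} (right f) = s≤s (≤-trans (factor-size-≤ f) (m≤n+m (size r) (size l)))

  join-one-sided : ∀ {A B : Pred (Fin m) 0ℓ} l r
    → arcs l ⊆ A ⊎ arcs l ⊆ B → arcs r ⊆ A ⊎ arcs r ⊆ B
    → (arcs l ⊆ A → arcs r ⊆ B → ⊥) → (arcs l ⊆ B → arcs r ⊆ A → ⊥)
    → (_∈ leaves l ++ leaves r) ⊆ A ⊎ (_∈ leaves l ++ leaves r) ⊆ B
  join-one-sided l r (inj₁ l⊆A) (inj₁ r⊆A) _ _ = inj₁ (arcs-++ l r l⊆A r⊆A)
  join-one-sided l r (inj₂ l⊆B) (inj₂ r⊆B) _ _ = inj₂ (arcs-++ l r l⊆B r⊆B)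
  join-one-sided l r (inj₁ l⊆A) (inj₂ r⊆B) mixed _ = ⊥-elim (mixed l⊆A r⊆B)
  join-one-sided l r (inj₂ l⊆B) (inj₁ r⊆A) _ mixed = ⊥-elim (mixed l⊆B r⊆A)

↭⇒∈-≐ : ∀ {A : Set} {xs ys : List A} → xs ↭ ys → (_∈ xs) ≐ (_∈ ys)
↭⇒∈-≐ xs↭ys = ∈-resp-↭ xs↭ys , ∈-resp-↭ (↭-sym xs↭ys)

module _ (D : Digraph) where

  private
    Arc    = Fin (nA D)
    Vertex = Fin (nV D)
    Tr     = Tree (nA D)

  Leaving Entering : Vertex → Pred Arc 0ℓ
  Leaving c a  = tail D a ≡ c
  Entering c a = head D a ≡ c

  -- Incident (arcs X) is VertexOf D X, and SeparatedAt (arcs l) (arcs r) w is the side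
  -- condition of a series node, both definitionally.
  Incident : Pred Arc 0ℓ → Pred Vertex 0ℓ
  Incident A c = ∃⟨ A ∩ (Leaving c ∪ Entering c) ⟩

  Shared : Pred Arc 0ℓ → Pred Arc 0ℓ → Pred Vertex 0ℓ
  Shared A B = Incident A ∩ Incident B

  SeparatedAt : Pred Arc 0ℓ → Pred Arc 0ℓ → Vertex → Set
  SeparatedAt A B w = ∀ c → Incident A c → Incident B c → c ≡ w

  Terminal : Vertex → Vertex → Pred Vertex 0ℓ
  Terminal u v c = c ≡ u ⊎ c ≡ v

  Realized : Pred Tr 0ℓ
  Realized X = ∃₂ (Realizes D X)

  some-⊆ : ∀ {A B P Q : Pred Arc 0ℓ} → A ⊆ B → P ⊆ Q → ∃⟨ A ∩ P ⟩ → ∃⟨ B ∩ Q ⟩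
  some-⊆ A⊆B P⊆Q (a , Aa , Pa) = a , A⊆B Aa , P⊆Q Pa

  incident-⊆ : ∀ {A B} → A ⊆ B → Incident A ⊆ Incident B
  incident-⊆ A⊆B = some-⊆ A⊆B id

  incident-∪ : ∀ {A B} → Incident (A ∪ B) ⊆ Incident A ∪ Incident B
  incident-∪ (a , inj₁ Aa , end) = inj₁ (a , Aa , end)
  incident-∪ (a , inj₂ Ba , end) = inj₂ (a , Ba , end)

  incident-++ : ∀ l r → Incident (_∈ leaves l ++ leaves r) ⊆ Incident (arcs l) ∪ Incident (arcs r)
  incident-++ l r c∈ = incident-∪ (incident-⊆ (∈-++⁻ (leaves l)) c∈)

  separated-sym : ∀ {A B w} → SeparatedAt A B w → SeparatedAt B A w
  separated-sym sep c cB cA = sep c cA cB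

  source-arc : ∀ X {x y} → Realizes D X x y → ∃⟨ arcs X ∩ Leaving x ⟩
  source-arc (leaf a)     (t , _ , _)  = a , here refl , t
  source-arc (node S l r) (_ , rl , _) = some-⊆ ∈-++⁺ˡ id (source-arc l rl)
  source-arc (node P l r) (rl , _)     = some-⊆ ∈-++⁺ˡ id (source-arc l rl)

  sink-arc : ∀ X {x y} → Realizes D X x y → ∃⟨ arcs X ∩ Entering y ⟩
  sink-arc (leaf a)     (_ , h , _)      = a , here refl , h
  sink-arc (node S l r) (_ , _ , rr , _) = some-⊆ (∈-++⁺ʳ (leaves l)) id (sink-arc r rr)
  sink-arc (node P l r) (rl , _)         = some-⊆ ∈-++⁺ˡ id (sink-arc l rl)

  source-incident : ∀ X {x y} → Realizes D X x y → Incident (arcs X) x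
  source-incident X rX = some-⊆ id inj₁ (source-arc X rX)

  sink-incident : ∀ X {x y} → Realizes D X x y → Incident (arcs X) y
  sink-incident X rX = some-⊆ id inj₂ (sink-arc X rX)

  source≢sink : ∀ X {x y} → Realizes D X x y → x ≢ y
  source≢sink (leaf _)     (_ , _ , x≢y)       = x≢y
  source≢sink (node S l r) (_ , rl , rr , sep) x≡y =
    source≢sink l rl (sep _ (source-incident l rl) (subst (Incident (arcs r)) (sym x≡y) (sink-incident r rr)))
  source≢sink (node P l r) (rl , _)             = source≢sink l rl

  loopless : ∀ X {x y a} → Realizes D X x y → a ∈ leaves X → tail D a ≢ head D a
  loopless (leaf _)     (t , h , x≢y) (here refl) t≡h = x≢y (trans (sym t) (trans t≡h h))
  loopless (leaf _)     _             (there ())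
  loopless (node S l r) (_ , rl , rr , _) a∈ = [ loopless l rl , loopless r rr ] (∈-++⁻ (leaves l) a∈)
  loopless (node P l r) (rl , rr , _)     a∈ = [ loopless l rl , loopless r rr ] (∈-++⁻ (leaves l) a∈)

  no-arc-enters-source : ∀ X {x y a} → Realizes D X x y → a ∈ leaves X → head D a ≢ x
  no-arc-enters-source (leaf _) (_ , h , x≢y) (here refl) h≡x = x≢y (trans (sym h≡x) h)
  no-arc-enters-source (leaf _) _ (there ())
  no-arc-enters-source (node S l r) {x} {a = a} (_ , rl , rr , sep) a∈ with ∈-++⁻ (leaves l) a∈
  ... | inj₁ a∈l = no-arc-enters-source l rl a∈l
  ... | inj₂ a∈r = λ h≡x →
    no-arc-enters-source r rr a∈r (trans h≡x (sep x (source-incident l rl) (a , a∈r , inj₂ h≡x)))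
  no-arc-enters-source (node P l r) (rl , rr , _) a∈ =
    [ no-arc-enters-source l rl , no-arc-enters-source r rr ] (∈-++⁻ (leaves l) a∈)

  no-arc-leaves-sink : ∀ X {x y a} → Realizes D X x y → a ∈ leaves X → tail D a ≢ y
  no-arc-leaves-sink (leaf _) (t , _ , x≢y) (here refl) t≡y = x≢y (trans (sym t) t≡y)
  no-arc-leaves-sink (leaf _) _ (there ())
  no-arc-leaves-sink (node S l r) {y = y} {a} (_ , rl , rr , sep) a∈ with ∈-++⁻ (leaves l) a∈
  ... | inj₁ a∈l = λ t≡y →
    no-arc-leaves-sink l rl a∈l (trans t≡y (sep y (a , a∈l , inj₁ t≡y) (sink-incident r rr)))
  ... | inj₂ a∈r = no-arc-leaves-sink r rr a∈r
  no-arc-leaves-sink (node P l r) (rl , rr , _) a∈ =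
    [ no-arc-leaves-sink l rl , no-arc-leaves-sink r rr ] (∈-++⁻ (leaves l) a∈)

  entering-arc : ∀ X {x y c} → Realizes D X x y → Incident (arcs X) c → c ≢ x → ∃⟨ arcs X ∩ Entering c ⟩
  entering-arc (leaf _) (t , _ , _) (_ , here refl , inj₁ tc) c≢x = ⊥-elim (c≢x (trans (sym tc) t))
  entering-arc (leaf a) _           (_ , here refl , inj₂ hc) _   = a , here refl , hc
  entering-arc (leaf _) _           (_ , there () , _)        _
  entering-arc (node S l r) {c = c} (z , rl , rr , _) c∈ c≢x with incident-++ l r c∈
  ... | inj₁ c∈l = some-⊆ ∈-++⁺ˡ id (entering-arc l rl c∈l c≢x)
  ... | inj₂ c∈r with c ≟ z
  ...   | yes refl = some-⊆ ∈-++⁺ˡ id (sink-arc l rl)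
  ...   | no c≢z   = some-⊆ (∈-++⁺ʳ (leaves l)) id (entering-arc r rr c∈r c≢z)
  entering-arc (node P l r) (rl , rr , _) c∈ c≢x with incident-++ l r c∈
  ... | inj₁ c∈l = some-⊆ ∈-++⁺ˡ id (entering-arc l rl c∈l c≢x)
  ... | inj₂ c∈r = some-⊆ (∈-++⁺ʳ (leaves l)) id (entering-arc r rr c∈r c≢x)

  leaving-arc : ∀ X {x y c} → Realizes D X x y → Incident (arcs X) c → c ≢ y → ∃⟨ arcs X ∩ Leaving c ⟩
  leaving-arc (leaf a) _           (_ , here refl , inj₁ tc) _   = a , here refl , tc
  leaving-arc (leaf _) (_ , h , _) (_ , here refl , inj₂ hc) c≢y = ⊥-elim (c≢y (trans (sym hc) h))
  leaving-arc (leaf _) _           (_ , there () , _)        _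
  leaving-arc (node S l r) {c = c} (z , rl , rr , _) c∈ c≢y with incident-++ l r c∈
  ... | inj₂ c∈r = some-⊆ (∈-++⁺ʳ (leaves l)) id (leaving-arc r rr c∈r c≢y)
  ... | inj₁ c∈l with c ≟ z
  ...   | yes refl = some-⊆ (∈-++⁺ʳ (leaves l)) id (source-arc r rr)
  ...   | no c≢z   = some-⊆ ∈-++⁺ˡ id (leaving-arc l rl c∈l c≢z)
  leaving-arc (node P l r) (rl , rr , _) c∈ c≢y with incident-++ l r c∈
  ... | inj₁ c∈l = some-⊆ ∈-++⁺ˡ id (leaving-arc l rl c∈l c≢y)
  ... | inj₂ c∈r = some-⊆ (∈-++⁺ʳ (leaves l)) id (leaving-arc r rr c∈r c≢y)

  same-arcs⇒same-source : ∀ X Y {x y x′ y′} → Realizes D X x y → Realizes D Y x′ y′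
    → arcs X ≐ arcs Y → x′ ≡ x
  same-arcs⇒same-source X Y rX rY (X⊆Y , Y⊆X) = decidable-stable (_ ≟ _) λ x′≢x →
    let a , a∈Y , ta = source-arc Y rY
        b , b∈X , hb = entering-arc X rX (a , Y⊆X a∈Y , inj₁ ta) x′≢x
    in no-arc-enters-source Y rY (X⊆Y b∈X) hb

  same-arcs⇒same-sink : ∀ X Y {x y x′ y′} → Realizes D X x y → Realizes D Y x′ y′
    → arcs X ≐ arcs Y → y′ ≡ y
  same-arcs⇒same-sink X Y rX rY (X⊆Y , Y⊆X) = decidable-stable (_ ≟ _) λ y′≢y →
    let a , a∈Y , ha = sink-arc Y rY
        b , b∈X , tb = leaving-arc X rX (a , Y⊆X a∈Y , inj₂ ha) y′≢y
    in no-arc-leaves-sink Y rY (X⊆Y b∈X) tb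

  crossing-visits-cut : ∀ {A B w} → SeparatedAt A B w → ∀ X {x y} → Realizes D X x y → arcs X ⊆ A ∪ B
    → Incident A x → Incident B y → Incident (arcs X) w
  crossing-visits-cut sep (leaf a) (t , h , _) cov xA yB with cov (here refl)
  ... | inj₁ Aa = a , here refl , inj₂ (trans h (sep _ (a , Aa , inj₂ h) yB))
  ... | inj₂ Ba = a , here refl , inj₁ (trans t (sep _ xA (a , Ba , inj₁ t)))
  crossing-visits-cut sep (node S l r) (_ , rl , rr , _) cov xA yB with sink-arc l rl
  ... | b , b∈l , hb with cov (∈-++⁺ˡ b∈l)
  ...   | inj₁ Ab = incident-⊆ (∈-++⁺ʳ (leaves l))
                      (crossing-visits-cut sep r rr (right-⊆ l r cov) (b , Ab , inj₂ hb) yB)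
  ...   | inj₂ Bb = incident-⊆ ∈-++⁺ˡ
                      (crossing-visits-cut sep l rl (left-⊆ l r cov) xA (b , Bb , inj₂ hb))
  crossing-visits-cut sep (node P l r) (rl , _) cov xA yB =
    incident-⊆ ∈-++⁺ˡ (crossing-visits-cut sep l rl (left-⊆ l r cov) xA yB)

  non-series-crosses-at-end : ∀ {A B w} → SeparatedAt A B w → ∀ X {x y} → ¬ Headed S X → Realizes D X x y
    → arcs X ⊆ A ∪ B → Incident A x → Incident B y → x ≡ w ⊎ y ≡ w
  non-series-crosses-at-end sep (leaf a) _ (t , h , _) cov xA yB with cov (here refl)
  ... | inj₁ Aa = inj₂ (sep _ (a , Aa , inj₂ h) yB)
  ... | inj₂ Ba = inj₁ (sep _ xA (a , Ba , inj₁ t))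
  non-series-crosses-at-end sep (node S l r) ¬h = ⊥-elim (¬h headed)
  non-series-crosses-at-end sep (node P l r) _ (rl , rr , sepP) cov xA yB =
    Sum.map sym sym (sepP _ (crossing-visits-cut sep l rl (left-⊆ l r cov) xA yB)
                            (crossing-visits-cut sep r rr (right-⊆ l r cov) xA yB))

  confined-to-side : ∀ {A B w} → SeparatedAt A B w → Incident A w → ∀ X {x y} → Realizes D X x y
    → arcs X ⊆ A ∪ B → Incident A x → Incident A y → arcs X ⊆ A
  confined-to-side sep wA (leaf a) (t , h , x≢y) cov xA yA (here refl) with cov (here refl)
  ... | inj₁ Aa = Aa
  ... | inj₂ Ba = ⊥-elim (x≢y (trans (sep _ xA (a , Ba , inj₁ t)) (sym (sep _ yA (a , Ba , inj₂ h)))))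
  confined-to-side sep wA (leaf a) _ _ _ _ (there ())
  confined-to-side sep wA (node P l r) (rl , rr , _) cov xA yA =
    arcs-++ l r (confined-to-side sep wA l rl (left-⊆ l r cov) xA yA)
                (confined-to-side sep wA r rr (right-⊆ l r cov) xA yA)
  confined-to-side {A} {B} {w} sep wA (node S l r) {x} {y} (z , rl , rr , sepS) cov xA yA =
    arcs-++ l r (confined-to-side sep wA l rl covˡ xA zA) (confined-to-side sep wA r rr covʳ zA yA)
    where
    covˡ : arcs l ⊆ A ∪ B
    covˡ = left-⊆ l r cov
    covʳ : arcs r ⊆ A ∪ B
    covʳ = right-⊆ l r cov
    -- If the arc entering z lies in B, the crossings x ⇝ z and z ⇝ y both visit w, so z = w.
    zA : Incident A z
    zA with sink-arc l rl
    ... | b , b∈l , hb with covˡ b∈l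
    ...   | inj₁ Ab = b , Ab , inj₂ hb
    ...   | inj₂ Bb = subst (Incident A) (sepS w
              (crossing-visits-cut sep l rl covˡ xA (b , Bb , inj₂ hb))
              (crossing-visits-cut (separated-sym sep) r rr (λ a∈ → Sum.swap (covʳ a∈)) (b , Bb , inj₂ hb) yA)) wA

  non-series-on-one-side : ∀ {A B w} → SeparatedAt A B w → Incident A w → Incident B w
    → ∀ X {x y} → ¬ Headed S X → Realizes D X x y → arcs X ⊆ A ∪ B → arcs X ⊆ A ⊎ arcs X ⊆ B
  non-series-on-one-side {A} {B} sep wA wB X {x} {y} ¬h rX cov =
    sides (end-side (source-incident X rX)) (end-side (sink-incident X rX))
    where
    end-side : ∀ {c} → Incident (arcs X) c → Incident A c ⊎ Incident B c
    end-side c∈ = incident-∪ (incident-⊆ cov c∈)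
    in-A : Incident A x → Incident A y → arcs X ⊆ A ⊎ arcs X ⊆ B
    in-A xA yA = inj₁ (confined-to-side sep wA X rX cov xA yA)
    in-B : Incident B x → Incident B y → arcs X ⊆ A ⊎ arcs X ⊆ B
    in-B xB yB = inj₂ (confined-to-side (separated-sym sep) wB X rX (λ a∈ → Sum.swap (cov a∈)) xB yB)
    sides : Incident A x ⊎ Incident B x → Incident A y ⊎ Incident B y → arcs X ⊆ A ⊎ arcs X ⊆ B
    sides (inj₁ xA) (inj₁ yA) = in-A xA yA
    sides (inj₂ xB) (inj₂ yB) = in-B xB yB
    sides (inj₁ xA) (inj₂ yB) =
      [ (λ x≡w → in-B (subst (Incident B) (sym x≡w) wB) yB)
      , (λ y≡w → in-A xA (subst (Incident A) (sym y≡w) wA)) ]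
        (non-series-crosses-at-end sep X ¬h rX cov xA yB)
    sides (inj₂ xB) (inj₁ yA) =
      [ (λ x≡w → in-A (subst (Incident A) (sym x≡w) wA) yA)
      , (λ y≡w → in-B xB (subst (Incident B) (sym y≡w) wB)) ]
        (non-series-crosses-at-end (separated-sym sep) X ¬h rX (λ a∈ → Sum.swap (cov a∈)) xB yA)

  non-series-not-within-series : ∀ F l r {u v} → ¬ Headed S F → Realizes D F u v → Realizes D (node S l r) u v
    → arcs F ⊆ arcs (node S l r) → ⊥
  non-series-not-within-series F l r ¬h rF (_ , rl , rr , sep) F⊆ =
    [ source≢sink l rl , (λ v≡w → source≢sink r rr (sym v≡w)) ]
      (non-series-crosses-at-end sep F ¬h rF (λ a∈ → ∈-++⁻ (leaves l) (F⊆ a∈))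
                                 (source-incident l rl) (sink-incident r rr))

  -- Only a parallel composition splits into two parts meeting at both terminals and nowhere else.
  one-sided-unless-parallel : ∀ {A B} X {x y} → Realizes D X x y → arcs X ⊆ A ∪ B
    → (∀ c → Incident (arcs X) c → Shared A B c → Terminal x y c)
    → ¬ Headed P X ⊎ ¬ (Shared A B x × Shared A B y)
    → arcs X ⊆ A ⊎ arcs X ⊆ B
  one-sided-unless-parallel (leaf a) _ cov _ _ with cov (here refl)
  ... | inj₁ Aa = inj₁ (arcs-leaf Aa)
  ... | inj₂ Ba = inj₂ (arcs-leaf Ba)
  one-sided-unless-parallel {A} {B} (node S l r) {x} {y} (z , rl , rr , sep) cov terminal _ =
    join-one-sided l r
      (one-sided-unless-parallel l rl (left-⊆ l r cov) terminalˡ (inj₂ (z-unshared ∘ proj₂)))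
      (one-sided-unless-parallel r rr (right-⊆ l r cov) terminalʳ (inj₂ (z-unshared ∘ proj₁)))
      (λ l⊆A r⊆B → z-unshared (incident-⊆ l⊆A (sink-incident l rl) , incident-⊆ r⊆B (source-incident r rr)))
      (λ l⊆B r⊆A → z-unshared (incident-⊆ r⊆A (source-incident r rr) , incident-⊆ l⊆B (sink-incident l rl)))
    where
    z-unshared : ¬ Shared A B z
    z-unshared zS with terminal z (incident-⊆ ∈-++⁺ˡ (sink-incident l rl)) zS
    ... | inj₁ z≡x = source≢sink l rl (sym z≡x)
    ... | inj₂ z≡y = source≢sink r rr z≡y
    terminalˡ : ∀ c → Incident (arcs l) c → Shared A B c → Terminal x z c
    terminalˡ c cl cS = Sum.map₂ (λ c≡y → sep c cl (subst (Incident (arcs r)) (sym c≡y) (sink-incident r rr)))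
                                 (terminal c (incident-⊆ ∈-++⁺ˡ cl) cS)
    terminalʳ : ∀ c → Incident (arcs r) c → Shared A B c → Terminal z y c
    terminalʳ c cr cS = Sum.map₁ (λ c≡x → sep c (subst (Incident (arcs l)) (sym c≡x) (source-incident l rl)) cr)
                                 (terminal c (incident-⊆ (∈-++⁺ʳ (leaves l)) cr) cS)
  one-sided-unless-parallel (node P l r) _ _ _ (inj₁ ¬h) = ⊥-elim (¬h headed)
  one-sided-unless-parallel (node P l r) (rl , rr , _) cov terminal (inj₂ ¬xy) =
    join-one-sided l r
      (one-sided-unless-parallel l rl (left-⊆ l r cov) (λ c cl → terminal c (incident-⊆ ∈-++⁺ˡ cl)) (inj₂ ¬xy))
      (one-sided-unless-parallel r rr (right-⊆ l r cov)
                                 (λ c cr → terminal c (incident-⊆ (∈-++⁺ʳ (leaves l)) cr)) (inj₂ ¬xy))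
      (λ l⊆A r⊆B → ¬xy ( (incident-⊆ l⊆A (source-incident l rl) , incident-⊆ r⊆B (source-incident r rr))
                       , (incident-⊆ l⊆A (sink-incident l rl)   , incident-⊆ r⊆B (sink-incident r rr))))
      (λ l⊆B r⊆A → ¬xy ( (incident-⊆ r⊆A (source-incident r rr) , incident-⊆ l⊆B (source-incident l rl))
                       , (incident-⊆ r⊆A (sink-incident r rr)   , incident-⊆ l⊆B (sink-incident l rl))))

  non-parallel-on-one-side : ∀ F l r {u v} → ¬ Headed P F → Realizes D F u v → Realizes D (node P l r) u v
    → arcs F ⊆ arcs (node P l r) → arcs F ⊆ arcs l ⊎ arcs F ⊆ arcs r
  non-parallel-on-one-side F l r ¬h rF (_ , _ , sep) F⊆ =
    one-sided-unless-parallel F rF (λ a∈ → ∈-++⁻ (leaves l) (F⊆ a∈)) (λ c _ (cl , cr) → sep c cl cr) (inj₁ ¬h)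

  factor-realized : ∀ {ℓ X F} → Factor ℓ X F → Realized X → Realized F
  factor-realized     (root _)  rX = rX
  factor-realized {S} (left f)  (_ , _ , _ , rl , _) = factor-realized f (_ , _ , rl)
  factor-realized {S} (right f) (_ , _ , _ , _ , rr , _) = factor-realized f (_ , _ , rr)
  factor-realized {P} (left f)  (_ , _ , rl , _) = factor-realized f (_ , _ , rl)
  factor-realized {P} (right f) (_ , _ , _ , rr , _) = factor-realized f (_ , _ , rr)

  parallel-factor-realizes : ∀ {X F u v} → Factor P X F → Realizes D X u v → Realizes D F u v
  parallel-factor-realizes (root _)  rX           = rX
  parallel-factor-realizes (left f)  (rl , _)     = parallel-factor-realizes f rl
  parallel-factor-realizes (right f) (_ , rr , _) = parallel-factor-realizes f rr

  factor-within-factor : ∀ ℓ {X Y F u v} → Factor ℓ X F → Realizes D X u v → Realizes D Y u v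
    → arcs F ⊆ arcs Y → ∃ λ G → Factor ℓ Y G × arcs F ⊆ arcs G
  factor-within-factor S {Y = Y} {F} f rX rY =
    descend-to-factor Realized {F} (λ { (_ , _ , _ , rl , rr , _) → (_ , _ , rl) , (_ , _ , rr) }) split Y (_ , _ , rY)
    where
    split : ∀ {l r} → Realized (node S l r) → arcs F ⊆ arcs (node S l r) → arcs F ⊆ arcs l ⊎ arcs F ⊆ arcs r
    split {l} {r} (_ , _ , _ , rl , rr , sep) F⊆ =
      non-series-on-one-side sep (sink-incident l rl) (source-incident r rr) F (factor-unheaded f)
        (proj₂ (proj₂ (factor-realized f (_ , _ , rX)))) (λ a∈ → ∈-++⁻ (leaves l) (F⊆ a∈))
  factor-within-factor P {Y = Y} {F} {u} {v} f rX rY =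
    descend-to-factor (λ Z → Realizes D Z u v) {F} (λ { (rl , rr , _) → rl , rr })
      (λ {l} {r} → non-parallel-on-one-side F l r (factor-unheaded f) (parallel-factor-realizes f rX)) Y rY

  arc-on-both-sides : ∀ ℓ l r {u v a} → Realizes D (node ℓ l r) u v → a ∈ leaves l → a ∈ leaves r
    → ℓ ≡ P × Terminal u v (tail D a) × Terminal u v (head D a)
  arc-on-both-sides S l r (_ , rl , _ , sep) a∈l a∈r =
    ⊥-elim (loopless l rl a∈l (trans (sep _ (_ , a∈l , inj₁ refl) (_ , a∈r , inj₁ refl))
                                     (sym (sep _ (_ , a∈l , inj₂ refl) (_ , a∈r , inj₂ refl)))))
  arc-on-both-sides P l r (_ , _ , sep) a∈l a∈r =
    refl , sep _ (_ , a∈l , inj₁ refl) (_ , a∈r , inj₁ refl)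
         , sep _ (_ , a∈l , inj₂ refl) (_ , a∈r , inj₂ refl)

  terminal-arc-is-whole : ∀ F {u v a} → ¬ Headed P F → Realizes D F u v → a ∈ leaves F
    → Terminal u v (tail D a) → Terminal u v (head D a) → F ≡ leaf a
  terminal-arc-is-whole (leaf _) _ _ (here refl) _ _ = refl
  terminal-arc-is-whole (leaf _) _ _ (there ())  _ _
  terminal-arc-is-whole (node P _ _) ¬h = ⊥-elim (¬h headed)
  terminal-arc-is-whole (node S l r) {u} {v} {a} _ (_ , rl , rr , sep) a∈ ta ha with ∈-++⁻ (leaves l) a∈
  ... | inj₁ a∈l = ⊥-elim (loopless l rl a∈l (trans (at-u ta (inj₁ refl)) (sym (at-u ha (inj₂ refl)))))
    where
    at-u : ∀ {c} → Terminal u v c → (Leaving c ∪ Entering c) a → c ≡ u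
    at-u (inj₁ c≡u) _   = c≡u
    at-u (inj₂ refl) end = ⊥-elim (source≢sink r rr (sym (sep v (a , a∈l , end) (sink-incident r rr))))
  ... | inj₂ a∈r = ⊥-elim (loopless r rr a∈r (trans (at-v ta (inj₁ refl)) (sym (at-v ha (inj₂ refl)))))
    where
    at-v : ∀ {c} → Terminal u v c → (Leaving c ∪ Entering c) a → c ≡ v
    at-v (inj₂ c≡v) _   = c≡v
    at-v (inj₁ refl) end = ⊥-elim (source≢sink l rl (sep u (source-incident l rl) (a , a∈r , end)))

  factors-overlap : ∀ {ℓ X F F′ u v a} → Factor ℓ X F → Factor ℓ X F′ → Realizes D X u v
    → a ∈ leaves F → a ∈ leaves F′ → arcs F′ ⊆ arcs F
  factors-overlap (root _)  (root _)  _ _ _ = id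
  factors-overlap (root ¬h) (left _)  _ _ _ = ⊥-elim (¬h headed)
  factors-overlap (root ¬h) (right _) _ _ _ = ⊥-elim (¬h headed)
  factors-overlap (left _)  (root ¬h) _ _ _ = ⊥-elim (¬h headed)
  factors-overlap (right _) (root ¬h) _ _ _ = ⊥-elim (¬h headed)
  factors-overlap {S} (left f)  (left f′)  (_ , rl , _)     = factors-overlap f f′ rl
  factors-overlap {P} (left f)  (left f′)  (rl , _)         = factors-overlap f f′ rl
  factors-overlap {S} (right f) (right f′) (_ , _ , rr , _) = factors-overlap f f′ rr
  factors-overlap {P} (right f) (right f′) (_ , rr , _)     = factors-overlap f f′ rr
  -- Factors on opposite sides can share an arc only below a parallel node; the arc then joins the
  -- terminals, so it is all of F′.
  factors-overlap {ℓ} (left {l} {r} f) (right f′) rX a∈F a∈F′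
    with arc-on-both-sides ℓ l r rX (factor-⊆ f a∈F) (factor-⊆ f′ a∈F′)
  ... | refl , ta , ha
    with terminal-arc-is-whole _ (factor-unheaded f′) (parallel-factor-realizes f′ (proj₁ (proj₂ rX))) a∈F′ ta ha
  ...   | refl = arcs-leaf a∈F
  factors-overlap {ℓ} (right {l} {r} f) (left f′) rX a∈F a∈F′
    with arc-on-both-sides ℓ l r rX (factor-⊆ f′ a∈F′) (factor-⊆ f a∈F)
  ... | refl , ta , ha
    with terminal-arc-is-whole _ (factor-unheaded f′) (parallel-factor-realizes f′ (proj₁ rX)) a∈F′ ta ha
  ...   | refl = arcs-leaf a∈F

  squeezed-between-factors : ∀ {ℓ X F F′ G u v} → Factor ℓ X F → Factor ℓ X F′ → Realizes D X u v
    → arcs F ⊆ arcs G → arcs G ⊆ arcs F′ → arcs F ≐ arcs G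
  squeezed-between-factors {F = F} f f′ rX F⊆G G⊆F′ =
    let _ , _ , rF   = factor-realized f (_ , _ , rX)
        a , a∈F , _  = source-arc F rF
        F′⊆F         = factors-overlap f f′ rX a∈F (G⊆F′ (F⊆G a∈F))
    in F⊆G , λ a∈G → F′⊆F (G⊆F′ a∈G)

  factor-matched : ∀ ℓ {X Y F u v} → Factor ℓ X F → Realizes D X u v → Realizes D Y u v → arcs X ≐ arcs Y
    → ∃ λ G → Factor ℓ Y G × ∃₂ λ x y → Realizes D F x y × Realizes D G x y × arcs F ≐ arcs G
  factor-matched ℓ {F = F} f rX rY (X⊆Y , Y⊆X) =
    let G , g , F⊆G  = factor-within-factor ℓ f rX rY (λ a∈ → X⊆Y (factor-⊆ f a∈))
        _ , f′ , G⊆F′ = factor-within-factor ℓ g rY rX (λ a∈ → Y⊆X (factor-⊆ g a∈))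
        F≐G          = squeezed-between-factors {G = G} f f′ rX F⊆G G⊆F′
        x , y , rF   = factor-realized f (_ , _ , rX)
        _ , _ , rG   = factor-realized g (_ , _ , rY)
    in G , g , x , y , rF
     , subst₂ (Realizes D G) (same-arcs⇒same-source F G rF rG F≐G) (same-arcs⇒same-sink F G rF rG F≐G) rG
     , F≐G

  same-arcs⇒φ-≤ : ∀ X Y {u v} → Acc _<_ (size X) → Realizes D X u v → Realizes D Y u v → arcs X ≐ arcs Y
    → φ X ≤ φ Y
  factors-φ-dominated : ∀ ℓ l r Y {u v} → WfRec _<_ (Acc _<_) (size (node ℓ l r))
    → Realizes D (node ℓ l r) u v → Realizes D Y u v → arcs (node ℓ l r) ≐ arcs Y
    → ∀ {F} → Factor ℓ (node ℓ l r) F → ∃ λ G → Factor ℓ Y G × φ F ≤ φ G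

  same-arcs⇒φ-≤ (leaf _) _ _ _ _ _ = z≤n
  same-arcs⇒φ-≤ (node S l r) Y@(node S _ _) (acc rec) rX rY X≐Y =
    s≤s (φ-within-≤ S (factors-φ-dominated S l r Y rec rX rY X≐Y))
  same-arcs⇒φ-≤ (node S l r) Y@(leaf _) _ rX rY (_ , Y⊆X) =
    ⊥-elim (non-series-not-within-series Y l r (λ ()) rY rX Y⊆X)
  same-arcs⇒φ-≤ (node S l r) Y@(node P _ _) _ rX rY (_ , Y⊆X) =
    ⊥-elim (non-series-not-within-series Y l r (λ ()) rY rX Y⊆X)
  same-arcs⇒φ-≤ X@(node P _ _) (node S l r) _ rX rY (X⊆Y , _) =
    ⊥-elim (non-series-not-within-series X l r (λ ()) rX rY X⊆Y)
  same-arcs⇒φ-≤ (node P l r) Y (acc rec) rX rY X≐Y =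
    φ-within-≤ P (factors-φ-dominated P l r Y rec rX rY X≐Y)

  factors-φ-dominated ℓ l r Y rec rX rY X≐Y f =
    let G , g , _ , _ , rF , rG , F≐G = factor-matched ℓ f rX rY X≐Y
    in G , g , same-arcs⇒φ-≤ _ G (rec (proper-factor-smaller f)) rF rG F≐G

lemma26 : (D : Digraph) (s t : Fin (nV D)) (T₁ T₂ : Tree (nA D))
    → IsDecompTree D s t T₁ → IsDecompTree D s t T₂ → φ T₁ ≡ φ T₂
lemma26 D _ _ T₁ T₂ (T₁↭ , _ , r₁) (T₂↭ , _ , r₂) =
  ≤-antisym (same-arcs⇒φ-≤ D T₁ T₂ (<-wellFounded _) r₁ r₂ T₁≐T₂)
            (same-arcs⇒φ-≤ D T₂ T₁ (<-wellFounded _) r₂ r₁ (≐-sym T₁≐T₂))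
  where
  T₁≐T₂ : arcs T₁ ≐ arcs T₂
  T₁≐T₂ = ≐-trans (↭⇒∈-≐ T₁↭) (≐-sym (↭⇒∈-≐ T₂↭))
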